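{- Let $\mathcal{M}=(E,r,m)$ be a ranked set with multiplicity. Then, as rational functions in $t,u_e,v_e$, $$\prod_{e\in E}(1-2v_e)\;\mathbf{Z}_{\mathcal{M}}\Bigl(t,\bigl(\tfrac{u_ev_e}{2v_e-1}\bigr)_{e\in E}\Bigr)=\sum_{A\subseteq E}(-1)^{|A|}\mathbf{Z}_{\mathcal{M}|A}\bigl(t,(u_e)_{e\in A}\bigr)\prod_{e\in A}v_e\prod_{e\in E\setminus A}(1-v_e).$$ Consequently, with $R=\mathbb{R}$ and $p_e\in[0,1]$, $$\mathbb{E}\bigl[(-1)^{|E_{\underline p}|}\mathbf{Z}_{\mathcal{M}|E_{\underline p}}(t,(u_e)_{e\in E_{\underline p}})\bigr]=\prod_{e\in E}(1-2p_e)\;\mathbf{Z}_{\mathcal{M}}\Bigl(t,\bigl(\tfrac{u_ep_e}{2p_e-1}\bigr)_{e\in E}\Bigr).$$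
   Context: A ranked set with multiplicity (rsm) is $\mathcal{M}=(E,r,m)$ with $E$ finite, $r:2^E\to\mathbb{Z}$ arbitrary ($r(\emptyset)$ may be nonzero), $m:2^E\to R$ arbitrary, $R$ a commutative ring with $1$. $\mathbf{Z}_{\mathcal{M}}(q,(v_e))=\sum_{A\subseteq E}m(A)q^{ -r(A)}\prod_{e\in A}v_e$. Restriction $\mathcal{M}|A=(A,r|_{2^A},m|_{2^A})$. $E_{\underline p}$ is the random subset containing each $e$ independently with probability $p_e$. The right-hand side of the expectation formula equals the polynomial $\sum_{A\subseteq E}m(A)t^{ -r(A)}\prod_{e\in A}(-u_ep_e)\prod_{e\in E\setminus A}(1-2p_e)$. -}

module Defs where

open import Level using (Level)
open import Algebra.Bundles using (CommutativeRing)
open import Data.Nat as ℕ using (ℕ; zero; suc)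
open import Data.Integer as ℤ using (ℤ; +_; -[1+_])
open import Data.Bool using (Bool; true; false; if_then_else_)
open import Data.Fin using (Fin)
open import Data.Fin.Subset using (Subset; ⊤; ∣_∣)
open import Data.Vec using (Vec; []; _∷_; lookup)
open import Data.List using (List; []; _∷_; map; _++_; foldr)

subsetsOf : {n : ℕ} → Subset n → List (Subset n)
subsetsOf [] = [] ∷ []
subsetsOf (true ∷ G) = map (true ∷_) (subsetsOf G) ++ map (false ∷_) (subsetsOf G)
subsetsOf (false ∷ G) = map (false ∷_) (subsetsOf G)

record RSM {c ℓ : Level} (R : CommutativeRing c ℓ) (n : ℕ) : Set c where
  field
    rank : Subset n → ℤ
    mult : Subset n → CommutativeRing.Carrier R

module _ {c ℓ : Level} (R : CommutativeRing c ℓ) where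
  open CommutativeRing R

  ΣL : {X : Set} → List X → (X → Carrier) → Carrier
  ΣL xs f = foldr (λ x acc → f x + acc) 0# xs

  ΠF : (n : ℕ) → (Fin n → Carrier) → Carrier
  ΠF zero f = 1#
  ΠF (suc n) f = f Fin.zero * ΠF n (λ i → f (Fin.suc i))

  Πin : {n : ℕ} → Subset n → (Fin n → Carrier) → Carrier
  Πin {n} A f = ΠF n (λ e → if lookup A e then f e else 1#)

  Πout : {n : ℕ} → Subset n → (Fin n → Carrier) → Carrier
  Πout {n} A f = ΠF n (λ e → if lookup A e then 1# else f e)

  pow : Carrier → ℕ → Carrier
  pow x zero = 1#
  pow x (suc k) = x * pow x k

  two : Carrier
  two = 1# + 1#

  -- integer power of a unit q with (given) inverse qinv
  zpow : Carrier → Carrier → ℤ → Carrier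
  zpow q qinv (+ k) = pow q k
  zpow q qinv -[1+ k ] = pow qinv (suc k)

  -- Z_{M|G}(q, (x_e)_{e∈G}) = Σ_{B ⊆ G} m(B) q^{-r(B)} ∏_{e∈B} x_e
  -- (restriction M|G keeps r and m on subsets of G; only x_e for e ∈ G are used)
  Zres : {n : ℕ} → RSM R n → Subset n → Carrier → Carrier → (Fin n → Carrier) → Carrier
  Zres M G q qinv x =
    ΣL (subsetsOf G) (λ B → RSM.mult M B * zpow q qinv (ℤ.- RSM.rank M B) * Πin B x)

  Z : {n : ℕ} → RSM R n → Carrier → Carrier → (Fin n → Carrier) → Carrier
  Z {n} M q qinv x = Zres M ⊤ q qinv x

  ΣA : (n : ℕ) → (Subset n → Carrier) → Carrier
  ΣA n f = ΣL (subsetsOf (⊤ {n})) f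

  Expect : (n : ℕ) → (Fin n → Carrier) → (Subset n → Carrier) → Carrier
  Expect n p X = ΣA n (λ A → Πin A p * Πout A (λ e → 1# - p e) * X A)

module Submission where

-- Only the weights c(B) = m(B) t^{-r(B)} of M matter, so we work with an
-- arbitrary weight function c on subsets and its generating polynomial
-- P_c(x)|_G = Σ_{B ⊆ G} c(B) x^B.  The heart of the proof is the identity
--   Σ_A (-1)^{|A|} P_c(u)|_A v^A (1-v)^{E∖A} = Σ_B c(B) (-uv)^B (1-2v)^{E∖B},
-- proved by induction on n: splitting every subset according to its first
-- element shows that both sides satisfy the same recursion (the two
-- coefficients of the "first element absent" part, -v and 1-v, add up to
-- 1-2v).  The right-hand side is exactly ∏(1-2v) P_c(uvw) when
-- w = 1/(2v-1), which gives the first statement; the second is the core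
-- identity with the summand reordered.

open import Defs
open import Level using (Level)
open import Algebra.Bundles using (CommutativeRing)
open import Data.Nat using (ℕ; zero; suc)
open import Data.Integer as ℤ using ()
open import Data.Bool using (true; false)
open import Data.Fin using (Fin)
open import Data.Fin.Subset using (Subset; ∣_∣; ⊤)
open import Data.Vec using ([]; _∷_)
open import Data.Vec.Functional using (head; tail)
open import Data.List using (List; []; _∷_; map; _++_)
open import Data.Product using (_×_; _,_)
import Algebra.Properties.Ring as RingProperties
import Algebra.Solver.Ring.NaturalCoefficients.Default as NaturalSolver

module AlternatingRestriction {c ℓ : Level} (R : CommutativeRing c ℓ) where
  open CommutativeRing R
  open RingProperties ring using (-1*x≈-x; -‿+-comm; -‿distribˡ-*; ⁻¹-anti-homo‿-)
  open NaturalSolver commutativeSemiring using (solve; _:=_; _:+_; _:*_; con)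
  open import Relation.Binary.Reasoning.Setoid setoid

  Σ-cong : {X : Set} (xs : List X) {f g : X → Carrier} →
    (∀ x → f x ≈ g x) → ΣL R xs f ≈ ΣL R xs g
  Σ-cong [] f≈g = refl
  Σ-cong (x ∷ xs) f≈g = +-cong (f≈g x) (Σ-cong xs f≈g)

  Σ-++ : {X : Set} (xs ys : List X) (f : X → Carrier) →
    ΣL R (xs ++ ys) f ≈ ΣL R xs f + ΣL R ys f
  Σ-++ [] ys f = sym (+-identityˡ _)
  Σ-++ (x ∷ xs) ys f = trans (+-congˡ (Σ-++ xs ys f)) (sym (+-assoc _ _ _))

  Σ-map : {X Y : Set} (g : X → Y) (xs : List X) (f : Y → Carrier) →
    ΣL R (map g xs) f ≈ ΣL R xs (λ x → f (g x))
  Σ-map g [] f = refl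
  Σ-map g (x ∷ xs) f = +-congˡ (Σ-map g xs f)

  Σ-+ : {X : Set} (xs : List X) (f g : X → Carrier) →
    ΣL R xs (λ x → f x + g x) ≈ ΣL R xs f + ΣL R xs g
  Σ-+ [] f g = sym (+-identityˡ _)
  Σ-+ (x ∷ xs) f g = trans (+-congˡ (Σ-+ xs f g))
    (solve 4 (λ a b c d → (a :+ b) :+ (c :+ d) := (a :+ c) :+ (b :+ d)) refl _ _ _ _)

  Σ-*ˡ : {X : Set} (xs : List X) (k : Carrier) (f : X → Carrier) →
    ΣL R xs (λ x → k * f x) ≈ k * ΣL R xs f
  Σ-*ˡ [] k f = sym (zeroʳ k)
  Σ-*ˡ (x ∷ xs) k f = trans (+-congˡ (Σ-*ˡ xs k f)) (sym (distribˡ k _ _))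

  Σ-subsets-with : {n : ℕ} (G : Subset n) (f : Subset (suc n) → Carrier) →
    ΣL R (subsetsOf (true ∷ G)) f
      ≈ ΣL R (subsetsOf G) (λ B → f (true ∷ B)) + ΣL R (subsetsOf G) (λ B → f (false ∷ B))
  Σ-subsets-with G f = begin
      ΣL R (map (true ∷_) S ++ map (false ∷_) S) f
    ≈⟨ Σ-++ (map (true ∷_) S) (map (false ∷_) S) f ⟩
      ΣL R (map (true ∷_) S) f + ΣL R (map (false ∷_) S) f
    ≈⟨ +-cong (Σ-map (true ∷_) S f) (Σ-map (false ∷_) S f) ⟩
      ΣL R S (λ B → f (true ∷ B)) + ΣL R S (λ B → f (false ∷ B))
    ∎
    where S = subsetsOf G

  Σ-subsets-without : {n : ℕ} (G : Subset n) (f : Subset (suc n) → Carrier) →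
    ΣL R (subsetsOf (false ∷ G)) f ≈ ΣL R (subsetsOf G) (λ B → f (false ∷ B))
  Σ-subsets-without G = Σ-map (false ∷_) (subsetsOf G)

  Πin-cong : {n : ℕ} (B : Subset n) {f g : Fin n → Carrier} →
    (∀ e → f e ≈ g e) → Πin R B f ≈ Πin R B g
  Πin-cong [] f≈g = refl
  Πin-cong (true ∷ B) f≈g = *-cong (f≈g Fin.zero) (Πin-cong B (λ e → f≈g (Fin.suc e)))
  Πin-cong (false ∷ B) f≈g = *-congˡ (Πin-cong B (λ e → f≈g (Fin.suc e)))

  ΠF-absorb : (n : ℕ) (f g : Fin n → Carrier) (B : Subset n) →
    ΠF R n f * Πin R B g ≈ Πin R B (λ e → f e * g e) * Πout R B f
  ΠF-absorb zero f g [] = refl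
  ΠF-absorb (suc n) f g (true ∷ B) = begin
      (head f * ΠF R n (tail f)) * (head g * Πin R B (tail g))
    ≈⟨ solve 4 (λ a P b Q → (a :* P) :* (b :* Q) := (a :* b) :* (P :* Q)) refl _ _ _ _ ⟩
      (head f * head g) * (ΠF R n (tail f) * Πin R B (tail g))
    ≈⟨ *-congˡ (ΠF-absorb n (tail f) (tail g) B) ⟩
      (head f * head g) * (Πin R B (λ e → tail f e * tail g e) * Πout R B (tail f))
    ≈⟨ solve 3 (λ a P Q → a :* (P :* Q) := a :* P :* (con 1 :* Q)) refl _ _ _ ⟩
      (head f * head g) * Πin R B (λ e → tail f e * tail g e) * (1# * Πout R B (tail f))
    ∎
  ΠF-absorb (suc n) f g (false ∷ B) = begin
      (head f * ΠF R n (tail f)) * (1# * Πin R B (tail g))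
    ≈⟨ solve 3 (λ a P Q → (a :* P) :* (con 1 :* Q) := a :* (P :* Q)) refl _ _ _ ⟩
      head f * (ΠF R n (tail f) * Πin R B (tail g))
    ≈⟨ *-congˡ (ΠF-absorb n (tail f) (tail g) B) ⟩
      head f * (Πin R B (λ e → tail f e * tail g e) * Πout R B (tail f))
    ≈⟨ solve 3 (λ a P Q → a :* (P :* Q) := con 1 :* P :* (a :* Q)) refl _ _ _ ⟩
      1# * Πin R B (λ e → tail f e * tail g e) * (head f * Πout R B (tail f))
    ∎

  Weight : ℕ → Set c
  Weight n = Subset n → Carrier

  Poly : {n : ℕ} → Weight n → (Fin n → Carrier) → Subset n → Carrier
  Poly w x G = ΣL R (subsetsOf G) (λ B → w B * Πin R B x)

  rsmWeight : {n : ℕ} → RSM R n → Carrier → Carrier → Weight n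
  rsmWeight M t tinv B = RSM.mult M B * zpow R t tinv (ℤ.- RSM.rank M B)

  withFirst withoutFirst : {n : ℕ} → Weight (suc n) → Weight n
  withFirst w B = w (true ∷ B)
  withoutFirst w B = w (false ∷ B)

  Poly-with : {n : ℕ} (w : Weight (suc n)) (x : Fin (suc n) → Carrier) (G : Subset n) →
    Poly w x (true ∷ G)
      ≈ head x * Poly (withFirst w) (tail x) G + Poly (withoutFirst w) (tail x) G
  Poly-with w x G = begin
      Poly w x (true ∷ G)
    ≈⟨ Σ-subsets-with G (λ B → w B * Πin R B x) ⟩
      ΣL R S (λ B → withFirst w B * (head x * Πin R B (tail x)))
        + ΣL R S (λ B → withoutFirst w B * (1# * Πin R B (tail x)))
    ≈⟨ +-cong (Σ-cong S (λ B → solve 3 (λ a b P → a :* (b :* P) := b :* (a :* P)) refl _ _ _))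
              (Σ-cong S (λ B → *-congˡ (*-identityˡ _))) ⟩
      ΣL R S (λ B → head x * (withFirst w B * Πin R B (tail x)))
        + Poly (withoutFirst w) (tail x) G
    ≈⟨ +-congʳ (Σ-*ˡ S (head x) _) ⟩
      head x * Poly (withFirst w) (tail x) G + Poly (withoutFirst w) (tail x) G
    ∎
    where S = subsetsOf G

  Poly-without : {n : ℕ} (w : Weight (suc n)) (x : Fin (suc n) → Carrier) (G : Subset n) →
    Poly w x (false ∷ G) ≈ Poly (withoutFirst w) (tail x) G
  Poly-without w x G = trans (Σ-subsets-without G (λ B → w B * Πin R B x))
    (Σ-cong (subsetsOf G) (λ B → *-congˡ (*-identityˡ _)))

  sign : {n : ℕ} → Subset n → Carrier
  sign A = pow R (- 1#) ∣ A ∣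

  alternatingTerm : {n : ℕ} → Weight n → (u v : Fin n → Carrier) → Subset n → Carrier
  alternatingTerm w u v A = sign A * Poly w u A * Πin R A v * Πout R A (λ e → 1# - v e)

  Alternating : (n : ℕ) → Weight n → (u v : Fin n → Carrier) → Carrier
  Alternating n w u v = ΣA R n (alternatingTerm w u v)

  twistedTerm : {n : ℕ} → Weight n → (u v : Fin n → Carrier) → Subset n → Carrier
  twistedTerm w u v B = w B * Πin R B (λ e → - (u e * v e)) * Πout R B (λ e → 1# - two R * v e)

  Twisted : (n : ℕ) → Weight n → (u v : Fin n → Carrier) → Carrier
  Twisted n w u v = ΣA R n (twistedTerm w u v)

  alternatingTerm-with : {n : ℕ} (w : Weight (suc n)) (u v : Fin (suc n) → Carrier) (A : Subset n) →
    alternatingTerm w u v (true ∷ A)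
      ≈ - (head u * head v) * alternatingTerm (withFirst w) (tail u) (tail v) A
        + - head v * alternatingTerm (withoutFirst w) (tail u) (tail v) A
  alternatingTerm-with w u v A = begin
      (- 1# * sign A) * Poly w u (true ∷ A) * (head v * Πv) * (1# * Πv̄)
    ≈⟨ *-congʳ (*-congʳ (*-congˡ (Poly-with w u A))) ⟩
      (- 1# * sign A) * (head u * P₁ + P₀) * (head v * Πv) * (1# * Πv̄)
    ≈⟨ solve 8 (λ m s a p₁ p₀ b V V̄ →
           (m :* s) :* (a :* p₁ :+ p₀) :* (b :* V) :* (con 1 :* V̄)
           := (m :* (a :* b)) :* (s :* p₁ :* V :* V̄) :+ (m :* b) :* (s :* p₀ :* V :* V̄))
         refl (- 1#) (sign A) (head u) P₁ P₀ (head v) Πv Πv̄ ⟩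
      (- 1# * (head u * head v)) * (sign A * P₁ * Πv * Πv̄)
        + (- 1# * head v) * (sign A * P₀ * Πv * Πv̄)
    ≈⟨ +-cong (*-congʳ (-1*x≈-x _)) (*-congʳ (-1*x≈-x _)) ⟩
      - (head u * head v) * (sign A * P₁ * Πv * Πv̄) + - head v * (sign A * P₀ * Πv * Πv̄)
    ∎
    where
      P₁ = Poly (withFirst w) (tail u) A
      P₀ = Poly (withoutFirst w) (tail u) A
      Πv = Πin R A (tail v)
      Πv̄ = Πout R A (λ e → 1# - tail v e)

  alternatingTerm-without : {n : ℕ} (w : Weight (suc n)) (u v : Fin (suc n) → Carrier) (A : Subset n) →
    alternatingTerm w u v (false ∷ A)
      ≈ (1# - head v) * alternatingTerm (withoutFirst w) (tail u) (tail v) A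
  alternatingTerm-without w u v A = begin
      sign A * Poly w u (false ∷ A) * (1# * Πv) * ((1# - head v) * Πv̄)
    ≈⟨ *-congʳ (*-congʳ (*-congˡ (Poly-without w u A))) ⟩
      sign A * P₀ * (1# * Πv) * ((1# - head v) * Πv̄)
    ≈⟨ solve 5 (λ s p₀ V b V̄ → s :* p₀ :* (con 1 :* V) :* (b :* V̄) := b :* (s :* p₀ :* V :* V̄))
         refl (sign A) P₀ Πv (1# - head v) Πv̄ ⟩
      (1# - head v) * (sign A * P₀ * Πv * Πv̄)
    ∎
    where
      P₀ = Poly (withoutFirst w) (tail u) A
      Πv = Πin R A (tail v)
      Πv̄ = Πout R A (λ e → 1# - tail v e)

  Alternating-step : (n : ℕ) (w : Weight (suc n)) (u v : Fin (suc n) → Carrier) →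
    Alternating (suc n) w u v
      ≈ - (head u * head v) * Alternating n (withFirst w) (tail u) (tail v)
        + (- head v + (1# - head v)) * Alternating n (withoutFirst w) (tail u) (tail v)
  Alternating-step n w u v = begin
      Alternating (suc n) w u v
    ≈⟨ Σ-subsets-with ⊤ (alternatingTerm w u v) ⟩
      ΣL R S (λ A → alternatingTerm w u v (true ∷ A)) + ΣL R S (λ A → alternatingTerm w u v (false ∷ A))
    ≈⟨ +-cong (Σ-cong S (alternatingTerm-with w u v)) (Σ-cong S (alternatingTerm-without w u v)) ⟩
      ΣL R S (λ A → a * T₁ A + b * T₀ A) + ΣL R S (λ A → b′ * T₀ A)
    ≈⟨ +-cong (trans (Σ-+ S _ _) (+-cong (Σ-*ˡ S a T₁) (Σ-*ˡ S b T₀))) (Σ-*ˡ S b′ T₀) ⟩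
      (a * ΣL R S T₁ + b * ΣL R S T₀) + b′ * ΣL R S T₀
    ≈⟨ solve 5 (λ a X b Y b′ → (a :* X :+ b :* Y) :+ b′ :* Y := a :* X :+ (b :+ b′) :* Y) refl _ _ _ _ _ ⟩
      a * ΣL R S T₁ + (b + b′) * ΣL R S T₀
    ∎
    where
      S = subsetsOf (⊤ {n})
      a = - (head u * head v)
      b = - head v
      b′ = 1# - head v
      T₁ = alternatingTerm (withFirst w) (tail u) (tail v)
      T₀ = alternatingTerm (withoutFirst w) (tail u) (tail v)

  Twisted-step : (n : ℕ) (w : Weight (suc n)) (u v : Fin (suc n) → Carrier) →
    Twisted (suc n) w u v
      ≈ - (head u * head v) * Twisted n (withFirst w) (tail u) (tail v)
        + (1# - two R * head v) * Twisted n (withoutFirst w) (tail u) (tail v)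
  Twisted-step n w u v = begin
      Twisted (suc n) w u v
    ≈⟨ Σ-subsets-with ⊤ (twistedTerm w u v) ⟩
      ΣL R S (λ B → twistedTerm w u v (true ∷ B)) + ΣL R S (λ B → twistedTerm w u v (false ∷ B))
    ≈⟨ +-cong (Σ-cong S (λ B → solve 4 (λ c a P Q → c :* (a :* P) :* (con 1 :* Q) := a :* (c :* P :* Q)) refl _ _ _ _))
              (Σ-cong S (λ B → solve 4 (λ c b P Q → c :* (con 1 :* P) :* (b :* Q) := b :* (c :* P :* Q)) refl _ _ _ _)) ⟩
      ΣL R S (λ B → a * T₁ B) + ΣL R S (λ B → b * T₀ B)
    ≈⟨ +-cong (Σ-*ˡ S a T₁) (Σ-*ˡ S b T₀) ⟩
      a * ΣL R S T₁ + b * ΣL R S T₀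
    ∎
    where
      S = subsetsOf (⊤ {n})
      a = - (head u * head v)
      b = 1# - two R * head v
      T₁ = twistedTerm (withFirst w) (tail u) (tail v)
      T₀ = twistedTerm (withoutFirst w) (tail u) (tail v)

  deletion-coefficient : ∀ v → - v + (1# - v) ≈ 1# - two R * v
  deletion-coefficient v = begin
      - v + (1# + - v)     ≈⟨ solve 3 (λ a o b → a :+ (o :+ b) := o :+ (a :+ b)) refl (- v) 1# (- v) ⟩
      1# + (- v + - v)     ≈⟨ +-congˡ (-‿+-comm v v) ⟩
      1# + - (v + v)       ≈⟨ +-congˡ (-‿cong (solve 1 (λ x → x :+ x := (con 1 :+ con 1) :* x) refl v)) ⟩
      1# + - (two R * v)   ∎

  alternating≈twisted : (n : ℕ) (w : Weight n) (u v : Fin n → Carrier) →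
    Alternating n w u v ≈ Twisted n w u v
  alternating≈twisted zero w u v =
    solve 1 (λ x → con 1 :* (x :* con 1 :+ con 0) :* con 1 :* con 1 :+ con 0 := x :* con 1 :* con 1 :+ con 0)
      refl (w [])
  alternating≈twisted (suc n) w u v = begin
      Alternating (suc n) w u v
    ≈⟨ Alternating-step n w u v ⟩
      a * Alternating n (withFirst w) u′ v′ + (- head v + (1# - head v)) * Alternating n (withoutFirst w) u′ v′
    ≈⟨ +-cong (*-congˡ (alternating≈twisted n (withFirst w) u′ v′))
              (*-cong (deletion-coefficient (head v)) (alternating≈twisted n (withoutFirst w) u′ v′)) ⟩
      a * Twisted n (withFirst w) u′ v′ + (1# - two R * head v) * Twisted n (withoutFirst w) u′ v′
    ≈⟨ Twisted-step n w u v ⟨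
      Twisted (suc n) w u v
    ∎
    where
      a = - (head u * head v)
      u′ = tail u
      v′ = tail v

  inverse-absorb : ∀ u v w → w * (two R * v - 1#) ≈ 1# →
    (1# - two R * v) * (u * v * w) ≈ - (u * v)
  inverse-absorb u v w w-inv = begin
      (1# - two R * v) * (u * v * w)     ≈⟨ *-congʳ (⁻¹-anti-homo‿- (two R * v) 1#) ⟨
      - d * (u * v * w)                  ≈⟨ -‿distribˡ-* d (u * v * w) ⟨
      - (d * (u * v * w))                ≈⟨ -‿cong (solve 3 (λ d x w → d :* (x :* w) := x :* (w :* d)) refl d (u * v) w) ⟩
      - (u * v * (w * d))                ≈⟨ -‿cong (trans (*-congˡ w-inv) (*-identityʳ _)) ⟩
      - (u * v)                          ∎
    where d = two R * v - 1#

  twisted-as-substitution : (n : ℕ) (w : Weight n) (u v x : Fin n → Carrier) →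
    (∀ e → x e * (two R * v e - 1#) ≈ 1#) →
    ΠF R n (λ e → 1# - two R * v e) * Poly w (λ e → u e * v e * x e) ⊤ ≈ Twisted n w u v
  twisted-as-substitution n w u v x x-inv = begin
      Π₂ * ΣL R S (λ B → w B * Πin R B uvx)
    ≈⟨ Σ-*ˡ S Π₂ _ ⟨
      ΣL R S (λ B → Π₂ * (w B * Πin R B uvx))
    ≈⟨ Σ-cong S rewrite-term ⟩
      Twisted n w u v
    ∎
    where
      S = subsetsOf (⊤ {n})
      f = λ e → 1# - two R * v e
      Π₂ = ΠF R n f
      uvx = λ e → u e * v e * x e
      rewrite-term : ∀ B → Π₂ * (w B * Πin R B uvx) ≈ twistedTerm w u v B
      rewrite-term B = begin
          Π₂ * (w B * Πin R B uvx)                                 ≈⟨ solve 3 (λ a b c → a :* (b :* c) := b :* (a :* c)) refl _ _ _ ⟩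
          w B * (Π₂ * Πin R B uvx)                                 ≈⟨ *-congˡ (ΠF-absorb n f uvx B) ⟩
          w B * (Πin R B (λ e → f e * uvx e) * Πout R B f)         ≈⟨ *-congˡ (*-congʳ (Πin-cong B (λ e → inverse-absorb (u e) (v e) (x e) (x-inv e)))) ⟩
          w B * (Πin R B (λ e → - (u e * v e)) * Πout R B f)       ≈⟨ *-assoc _ _ _ ⟨
          twistedTerm w u v B                                      ∎

  expectation≈alternating : (n : ℕ) (w : Weight n) (u p : Fin n → Carrier) →
    Expect R n p (λ A → sign A * Poly w u A) ≈ Alternating n w u p
  expectation≈alternating n w u p = Σ-cong (subsetsOf (⊤ {n})) (λ A →
    solve 4 (λ a b c d → a :* b :* (c :* d) := c :* d :* a :* b) refl
      (Πin R A p) (Πout R A (λ e → 1# - p e)) (sign A) (Poly w u A))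

theorem4p7 : {c ℓ : Level} (R : CommutativeRing c ℓ) (n : ℕ) (M : RSM R n) →
    let open CommutativeRing R in
    ((t tinv : Carrier) (u v w : Fin n → Carrier) →
    t * tinv ≈ 1# →
    (∀ e → w e * (two R * v e - 1#) ≈ 1#) →
    ΠF R n (λ e → 1# - two R * v e) * Z R M t tinv (λ e → u e * v e * w e)
    ≈ ΣA R n (λ A → pow R (- 1#) ∣ A ∣ * Zres R M A t tinv u
    * Πin R A v * Πout R A (λ e → 1# - v e)))
    ×
    ((t tinv : Carrier) (u p : Fin n → Carrier) →
    t * tinv ≈ 1# →
    Expect R n p (λ A → pow R (- 1#) ∣ A ∣ * Zres R M A t tinv u)
    ≈ ΣA R n (λ A → RSM.mult M A * zpow R t tinv (ℤ.- RSM.rank M A)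
    * Πin R A (λ e → - (u e * p e))
    * Πout R A (λ e → 1# - two R * p e)))
theorem4p7 R n M =
    (λ t tinv u v w _ w-inv →
      trans (twisted-as-substitution n (rsmWeight M t tinv) u v w w-inv)
            (sym (alternating≈twisted n (rsmWeight M t tinv) u v)))
  , (λ t tinv u p _ →
      trans (expectation≈alternating n (rsmWeight M t tinv) u p)
            (alternating≈twisted n (rsmWeight M t tinv) u p))
  where
    open CommutativeRing R using (sym; trans)
    open AlternatingRestriction R
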